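{- For all positive integers $s$ and $k$, there exist rooted, locally finite trees $T_1$ and $T_2$ such that $T_1$ satisfies $\mathrm{KEIN}_{s}$, $T_2$ satisfies $\neg\mathrm{KEIN}_{s}$, and Duplicator has a winning strategy in the game $\mathrm{ehr}[T_1,T_2,s;k]$.
   Context: Rooted trees are directed from parent to child with root $R$; $\pi(y)=x$ means $x$ is the parent of $y$. Define $P_0(x)$: "$x$ has no child", and for $i\geq1$, $P_i(x)$: "for every child $y$ of $x$, $P_{i-1}(y)$ fails". Let $\mathrm{KEIN}_i := P_i(R)$. The game $\mathrm{ehr}[T_1,T_2,s;k]$ on rooted trees $T_1$ (root $R_1$) and $T_2$ (root $R_2$) is played by Spoiler and Duplicator for $sk$ rounds, divided into $s$ consecutive batches of $k$ rounds. Before the first round Spoiler picks one of the two trees; in each round of the first batch Spoiler chooses a vertex of that tree and Duplicator responds with a vertex of the other tree; in the next batch Spoiler chooses vertices in the other tree (Duplicator responding in the first), and so on, alternating trees between batches. Let $x_i\in V(T_1)$, $y_i\in V(T_2)$ be the vertices chosen in round $i$, and set $x_0=R_1$, $y_0=R_2$. Duplicator wins if for all $i,j\in\{0,1,\dots,sk\}$: $\pi(x_j)=x_i \Leftrightarrow \pi(y_j)=y_i$, and $x_i=x_j\Leftrightarrow y_i=y_j$. -}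

module Defs where

open import Data.Nat using (ℕ; zero; suc)
open import Data.Bool using (Bool; true; false; not)
open import Data.Maybe using (Maybe; just; nothing)
open import Data.List using (List; []; _∷_; _++_; replicate)
open import Data.List.Membership.Propositional using (_∈_)
open import Data.Product using (Σ; ∃; _×_; _,_)
open import Relation.Nullary using (¬_)
open import Data.Empty using (⊥)
open import Relation.Binary.PropositionalEquality using (_≡_)
open import Function.Bundles using (_⇔_)

-- A rooted tree, given by its vertex set V, its root, and the parent map π
-- (π y ≡ just x  means  x is the parent of y; the root has no parent).
data ReachesRoot {V : Set} (root : V) (π : V → Maybe V) : V → Set where
  here : ReachesRoot root π root
  step : ∀ {x y} → π y ≡ just x → ReachesRoot root π x → ReachesRoot root π y

record RootedTree : Set₁ where
  field
    V    : Set
    root : V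
    π    : V → Maybe V
    π-root    : π root ≡ nothing
    connected : ∀ v → ReachesRoot root π v

open RootedTree public

LocallyFinite : RootedTree → Set
LocallyFinite T = ∀ x → Σ (List (V T)) λ L → ∀ y → (π T y ≡ just x) ⇔ (y ∈ L)

P : (T : RootedTree) → ℕ → V T → Set
P T zero    x = ∀ y → π T y ≡ just x → ⊥
P T (suc i) x = ∀ y → π T y ≡ just x → ¬ P T i y

KEIN : ℕ → RootedTree → Set
KEIN i T = P T i (root T)

-- The game ehr[T₁,T₂,s;k].
-- Side true = Spoiler plays in T₁, false = Spoiler plays in T₂.
schedule : Bool → ℕ → ℕ → List Bool
schedule first zero    k = []
schedule first (suc s) k = replicate k first ++ schedule (not first) s k

module _ (T₁ T₂ : RootedTree) where
  Good : List (V T₁ × V T₂) → Set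
  Good h = ∀ {x₁ y₁ x₂ y₂} → (x₁ , y₁) ∈ h → (x₂ , y₂) ∈ h →
             ((π T₁ x₂ ≡ just x₁) ⇔ (π T₂ y₂ ≡ just y₁))
           × ((x₁ ≡ x₂) ⇔ (y₁ ≡ y₂))

  -- Duplicator wins the remaining rounds (sides given by the list),
  -- from history h (list of chosen pairs, most recent first)
  DupWins : List Bool → List (V T₁ × V T₂) → Set
  DupWins []            h = Good h
  DupWins (true  ∷ rest) h = ∀ x → ∃ λ y → DupWins rest ((x , y) ∷ h)
  DupWins (false ∷ rest) h = ∀ y → ∃ λ x → DupWins rest ((x , y) ∷ h)

  DuplicatorWinsEhr : ℕ → ℕ → Set
  DuplicatorWinsEhr s k =
    ∀ first → DupWins (schedule first s k) ((root T₁ , root T₂) ∷ [])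

-- T₁ and T₂ are grown from shapes: A 0 is a leaf, A (i+1) has N children of shape B i, B 0 has
-- N leaves as children, and B (i+1) has one child of shape A i and N − 1 of shape B i.  By
-- induction A i satisfies P_i and B i does not, so T₁ = A s and T₂ = B s separate KEIN_s.
--
-- Duplicator maintains an ancestor-closed partial isomorphism between paths whose matched
-- vertices have equal shapes, or are A j against B j with r ≤ j + 1, or B j against A j with
-- r ≤ j (Spoiler's tree first, r the number of batches left).  A move below equal shapes is
-- copied; any other move is answered by an unused child of shape B, which exists because N
-- exceeds the number of matched pairs.  The shapes stay apart only when Spoiler moves from B j
-- to its A-child, leaving A (j−1) against B (j−1); splitting them again requires a change of
-- tree, which costs a batch, so Spoiler never reaches a leaf matched with a non-leaf.

module Submission where

open import Defs
open import Data.Nat using (ℕ; zero; suc; pred; _+_; _*_; _≤_; _<_; _<ᵇ_; z≤n; s≤s; z<s)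
open import Data.Nat.Properties
  using (_≟_; ≤-refl; ≤-reflexive; ≤-trans; ≤-pred; ≤-<-trans; n≤1+n; m≤m+n; m<n⇒m<1+n; <⇒≤;
         ≤∧≢⇒<; +-suc; +-assoc; +-monoˡ-≤; +-monoʳ-≤; <ᵇ⇒<; <⇒<ᵇ; module ≤-Reasoning)
open import Data.Bool using (Bool; true; false; not; T; if_then_else_)
open import Data.Bool.Properties using (T?; T-irrelevant)
open import Data.Unit using (tt)
open import Data.Empty using (⊥-elim)
open import Data.Fin using (toℕ)
open import Data.Fin.Properties using (pigeonhole; toℕ-injective; toℕ<n; ¬∀⟶∃¬; <⇒≢)
open import Data.Maybe using (Maybe; just; nothing; is-just; _>>=_)
open import Data.Maybe.Properties using (just-injective)
open import Data.List using (List; []; _∷_; _++_; length; map; replicate; tail; lookup)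
open import Data.List.Properties using (length-map; map-++; map-replicate; ≡-dec)
open import Data.List.Relation.Unary.Any using (here; there; index)
open import Data.List.Relation.Unary.Any.Properties using (lookup-index)
open import Data.List.Relation.Binary.Subset.Propositional using (_⊆_)
open import Data.List.Membership.Propositional using (_∈_; _∉_)
open import Data.List.Membership.Propositional.Properties using (∈-map⁺; ∈-map⁻)
open import Data.List.Membership.DecPropositional _≟_ using (_∈?_)
open import Data.List.Membership.DecPropositional (≡-dec _≟_) using () renaming (_∈?_ to _∈ₗ?_)
open import Data.Product using (Σ; ∃; ∃₂; _×_; _,_; proj₁; proj₂; swap)
open import Function using (_∘_; id)
open import Function.Bundles using (_⇔_; mk⇔; Equivalence)
open import Function.Construct.Symmetry using (⇔-sym)
open import Function.Construct.Composition using (_⇔-∘_)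
open import Relation.Nullary using (¬_; yes; no)
open import Relation.Binary.PropositionalEquality
  using (_≡_; _≢_; refl; sym; trans; cong; cong₂; subst; module ≡-Reasoning)

open Equivalence using (to; from)

∃∉≤length : (U : List ℕ) → ∃ λ d → d ≤ length U × d ∉ U
∃∉≤length U =
  let i , i∉U = ¬∀⟶∃¬ (suc (length U)) (λ i → toℕ i ∈ U) (λ i → toℕ i ∈? U) allIn⇒⊥
  in toℕ i , ≤-pred (toℕ<n i) , i∉U
  where
  allIn⇒⊥ : ¬ (∀ i → toℕ i ∈ U)
  allIn⇒⊥ allIn with i , j , i<j , same ← pigeonhole ≤-refl (index ∘ allIn) =
    <⇒≢ i<j (toℕ-injective (begin
      toℕ i                      ≡⟨ lookup-index (allIn i) ⟩
      lookup U (index (allIn i)) ≡⟨ cong (lookup U) same ⟩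
      lookup U (index (allIn j)) ≡⟨ lookup-index (allIn j) ⟨
      toℕ j                      ∎))
    where open ≡-Reasoning

∈-map-swap⁻ : ∀ {A B : Set} {xs : List (A × B)} {a b} → (b , a) ∈ map swap xs → (a , b) ∈ xs
∈-map-swap⁻ m with _ , m′ , refl ← ∈-map⁻ swap m = m′

schedule-not : ∀ b s k → schedule (not b) s k ≡ map not (schedule b s k)
schedule-not b zero    k = refl
schedule-not b (suc s) k = begin
  replicate k (not b) ++ schedule (not (not b)) s k
    ≡⟨ cong₂ _++_ (sym (map-replicate not k b)) (schedule-not (not b) s k) ⟩
  map not (replicate k b) ++ map not (schedule (not b) s k)
    ≡⟨ map-++ not (replicate k b) _ ⟨
  map not (replicate k b ++ schedule (not b) s k) ∎
  where open ≡-Reasoning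

Good-swap : ∀ T₁ T₂ {h} → Good T₂ T₁ (map swap h) → Good T₁ T₂ h
Good-swap T₁ T₂ good m₁ m₂ with parents , equal ← good (∈-map⁺ swap m₁) (∈-map⁺ swap m₂) =
  ⇔-sym parents , ⇔-sym equal

DupWins-swap : ∀ T₁ T₂ l {h} → DupWins T₂ T₁ l (map swap h) → DupWins T₁ T₂ (map not l) h
DupWins-swap T₁ T₂ []          wins   = Good-swap T₁ T₂ wins
DupWins-swap T₁ T₂ (true  ∷ l) wins y = let x , wins′ = wins y in x , DupWins-swap T₁ T₂ l wins′
DupWins-swap T₁ T₂ (false ∷ l) wins x = let y , wins′ = wins x in y , DupWins-swap T₁ T₂ l wins′

-- Inv i j r R h: Spoiler is about to play in T i, with r batches and R rounds left in total.
module ByInvariant {I : Set} (T : I → RootedTree) (k : ℕ)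
  (Inv : ∀ i j → ℕ → ℕ → List (V (T i) × V (T j)) → Set)
  (respond : ∀ {i j r R h} → Inv i j (suc r) (suc R) h →
             ∀ x → ∃ λ y → Inv i j (suc r) R ((x , y) ∷ h))
  (switch : ∀ {i j r R h} → Inv i j (suc r) R h → Inv j i r R (map swap h))
  (good : ∀ {i j h} → Inv i j 0 0 h → Good (T i) (T j) h)
  where

  batch : ∀ n {i j r R h rest} → Inv i j (suc r) (n + R) h →
          (∀ {h′} → Inv i j (suc r) R h′ → DupWins (T i) (T j) rest h′) →
          DupWins (T i) (T j) (replicate n true ++ rest) h
  batch zero    inv continue   = continue inv
  batch (suc n) inv continue x = let y , inv′ = respond inv x in y , batch n inv′ continue

  dupWins : ∀ s {i j h} → Inv i j s (s * k) h → DupWins (T i) (T j) (schedule true s k) h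
  dupWins zero    inv = good inv
  dupWins (suc s) {i} {j} inv = batch k inv λ inv′ →
    subst (λ l → DupWins (T i) (T j) l _) (sym (schedule-not true s k))
      (DupWins-swap (T i) (T j) _ (dupWins s (switch inv′)))

-- Vertices are paths from the root, written as lists of child indices with the last step first;
-- a vertex of shape u has a child at index c iff c < width and branch u c is defined.
module Generated {S : Set} (branch : S → ℕ → Maybe S) (width : ℕ) where

  child : S → ℕ → Maybe S
  child u c = if c <ᵇ width then branch u c else nothing

  child⇒branch : ∀ {u c u′} → child u c ≡ just u′ → c < width × branch u c ≡ just u′
  child⇒branch {u} {c} e with c <ᵇ width in c<w
  child⇒branch {u} {c} e  | true = <ᵇ⇒< c width (subst T (sym c<w) tt) , e
  child⇒branch {u} {c} () | false

  branch⇒child : ∀ {u c} → c < width → child u c ≡ branch u c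
  branch⇒child {u} {c} c<w with c <ᵇ width | <⇒<ᵇ c<w
  ... | true | _ = refl

  shapeAt : S → List ℕ → Maybe S
  shapeAt t []      = just t
  shapeAt t (c ∷ p) = shapeAt t p >>= λ u → child u c

  shapeAt-∷ : ∀ {t} p {c u} → shapeAt t p ≡ just u → shapeAt t (c ∷ p) ≡ child u c
  shapeAt-∷ p {c} e = cong (_>>= λ u → child u c) e

  shapeAt-∷⁻ : ∀ {t c} p {u′} → shapeAt t (c ∷ p) ≡ just u′ →
               ∃ λ u → shapeAt t p ≡ just u × child u c ≡ just u′
  shapeAt-∷⁻ {t} p e with shapeAt t p
  shapeAt-∷⁻ p e  | just u  = u , refl , e
  shapeAt-∷⁻ p () | nothing

  Valid : S → List ℕ → Set
  Valid t p = T (is-just (shapeAt t p))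

  Vertex : S → Set
  Vertex t = Σ (List ℕ) (Valid t)

  path : ∀ {t} → Vertex t → List ℕ
  path = proj₁

  valid⇒shape : ∀ {t} p → Valid t p → ∃ λ u → shapeAt t p ≡ just u
  valid⇒shape {t} p v with shapeAt t p | v
  ... | just u | _ = u , refl

  shape⇒valid : ∀ {t} p {u} → shapeAt t p ≡ just u → Valid t p
  shape⇒valid p e = subst (T ∘ is-just) (sym e) tt

  valid-∷ : ∀ {t c} p → Valid t (c ∷ p) → Valid t p
  valid-∷ {t} {c} p v with _ , e ← valid⇒shape {t} (c ∷ p) v =
    shape⇒valid p (proj₁ (proj₂ (shapeAt-∷⁻ p e)))

  valid⇒< : ∀ {t c} p → Valid t (c ∷ p) → c < width
  valid⇒< {t} {c} p v with _ , e ← valid⇒shape {t} (c ∷ p) v =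
    proj₁ (child⇒branch (proj₂ (proj₂ (shapeAt-∷⁻ p e))))

  vertex-≡ : ∀ {t} {x y : Vertex t} → path x ≡ path y → x ≡ y
  vertex-≡ {x = p , v} {.p , w} refl = cong (p ,_) (T-irrelevant v w)

  path-≡⇔ : ∀ {t} {x y : Vertex t} → (x ≡ y) ⇔ (path x ≡ path y)
  path-≡⇔ = mk⇔ (cong path) vertex-≡

  parent : ∀ {t} → Vertex t → Maybe (Vertex t)
  parent ([] , _)    = nothing
  parent (c ∷ p , v) = just (p , valid-∷ p v)

  reachesRoot : ∀ {t} p (v : Valid t p) → ReachesRoot ([] , tt) parent (p , v)
  reachesRoot []      tt = here
  reachesRoot (c ∷ p) v  = step refl (reachesRoot p (valid-∷ p v))

  tree : S → RootedTree
  tree t = record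
    { V = Vertex t ; root = [] , tt ; π = parent ; π-root = refl
    ; connected = λ (p , v) → reachesRoot p v }

  parent⇔tail : ∀ {t} (x y : Vertex t) → (parent y ≡ just x) ⇔ (tail (path y) ≡ just (path x))
  parent⇔tail x ([] , _)    = mk⇔ (λ ()) (λ ())
  parent⇔tail x (c ∷ p , v) =
    mk⇔ (cong (just ∘ path) ∘ just-injective) (cong just ∘ vertex-≡ ∘ just-injective)

  children : ∀ t → List ℕ → ℕ → List (Vertex t)
  children t p zero    = []
  children t p (suc c) with T? (is-just (shapeAt t (c ∷ p)))
  ... | yes v = (c ∷ p , v) ∷ children t p c
  ... | no _  = children t p c

  ∈-children : ∀ {t p c n} (v : Valid t (c ∷ p)) → c < n → (c ∷ p , v) ∈ children t p n
  ∈-children {t} {p} {c} {suc n} v c<1+n with T? (is-just (shapeAt t (n ∷ p))) | c ≟ n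
  ... | yes _  | yes refl = here (vertex-≡ refl)
  ... | no ¬v  | yes refl = ⊥-elim (¬v v)
  ... | yes _  | no c≢n   = there (∈-children v (≤∧≢⇒< (≤-pred c<1+n) c≢n))
  ... | no _   | no c≢n   = ∈-children v (≤∧≢⇒< (≤-pred c<1+n) c≢n)

  children-∈ : ∀ {t p n y} → y ∈ children t p n → tail (path y) ≡ just p
  children-∈ {t} {p} {suc n} m with T? (is-just (shapeAt t (n ∷ p))) | m
  ... | yes _ | here refl = refl
  ... | yes _ | there m′  = children-∈ {n = n} m′
  ... | no _  | m′        = children-∈ {n = n} m′

  locallyFinite : ∀ t → LocallyFinite (tree t)
  locallyFinite t x@(p , _) =
    children t p width , λ y → mk⇔ (parent⇒∈ y) (from (parent⇔tail x y) ∘ children-∈ {n = width})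
    where
    parent⇒∈ : ∀ y → parent y ≡ just x → y ∈ children t p width
    parent⇒∈ ([] , _) ()
    parent⇒∈ (c ∷ q , w) e with refl ← cong path (just-injective e) = ∈-children w (valid⇒< q w)

  parent-shape : ∀ {t} {x y : Vertex t} {u} → parent y ≡ just x → shapeAt t (path x) ≡ just u →
                 ∃₂ λ c u′ → branch u c ≡ just u′ × shapeAt t (path y) ≡ just u′
  parent-shape {y = [] , _} ()
  parent-shape {x = x} {y = c ∷ p , v} e ex with refl ← cong path (just-injective e)
    with u′ , ey ← valid⇒shape (c ∷ p) v =
    c , u′ , proj₂ (child⇒branch (trans (sym (shapeAt-∷ (path x) ex)) ey)) , ey

  child-vertex : ∀ {t} (x : Vertex t) {u c u′} → shapeAt t (path x) ≡ just u → c < width →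
                 branch u c ≡ just u′ →
                 Σ (Vertex t) λ y → parent y ≡ just x × shapeAt t (path y) ≡ just u′
  child-vertex x {c = c} ex c<w b =
    (c ∷ path x , shape⇒valid (c ∷ path x) ey) , cong just (vertex-≡ refl) , ey
    where ey = trans (shapeAt-∷ (path x) ex) (trans (branch⇒child c<w) b)

data Shape : Set where
  A B : ℕ → Shape

branch : Shape → ℕ → Maybe Shape
branch (A zero)    _       = nothing
branch (A (suc i)) _       = just (B i)
branch (B zero)    _       = just (A zero)
branch (B (suc i)) zero    = just (A i)
branch (B (suc i)) (suc _) = just (B i)

height : Shape → ℕ
height (A zero)    = 0
height (A (suc i)) = suc (height (B i))
height (B zero)    = 1
height (B (suc i)) = suc (height (B i))

height-A≤B : ∀ i → height (A i) ≤ height (B i)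
height-A≤B zero    = z≤n
height-A≤B (suc i) = ≤-refl

branch-height : ∀ {u c u′} → branch u c ≡ just u′ → height u′ < height u
branch-height {A (suc i)}           refl = ≤-refl
branch-height {B zero}              refl = z<s
branch-height {B (suc i)} {zero}    refl = s≤s (height-A≤B i)
branch-height {B (suc i)} {suc _}   refl = ≤-refl

-- Safe r u w: matched vertices of shapes u (in the tree Spoiler currently plays in) and w,
-- which Duplicator can keep indistinguishable for the r batches left, the current one included.
data Safe (r : ℕ) : Shape → Shape → Set where
  same : ∀ {u} → Safe r u u
  A~B  : ∀ {j} → r ≤ suc j → Safe r (A j) (B j)
  B~A  : ∀ {j} → r ≤ j → Safe r (B j) (A j)

Safe-swap : ∀ {r u w} → Safe (suc r) u w → Safe r w u
Safe-swap same       = same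
Safe-swap (A~B r<j′) = B~A (≤-pred r<j′)
Safe-swap (B~A r<j)  = A~B (<⇒≤ (m<n⇒m<1+n r<j))

fresh-reply : ∀ {r u w c u′} → 0 < r → Safe r u w → u ≢ w → branch u c ≡ just u′ →
              ∃ λ w′ → (∀ e → branch w (suc e) ≡ just w′) × Safe r u′ w′
fresh-reply _ same                          u≢u _    = ⊥-elim (u≢u refl)
fresh-reply _ (A~B {suc i} _)               _   refl = B i , (λ _ → refl) , same
fresh-reply z<s (B~A {zero} ())
fresh-reply {c = zero}  _ (B~A {suc i} r≤) _ refl = B i , (λ _ → refl) , A~B r≤
fresh-reply {c = suc _} _ (B~A {suc i} _)  _ refl = B i , (λ _ → refl) , same

PathRel : Set
PathRel = List (List ℕ × List ℕ)

Unmatchedˡ : List ℕ → PathRel → Set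
Unmatchedˡ a H = ∀ {b} → (a , b) ∉ H

Unmatchedʳ : List ℕ → PathRel → Set
Unmatchedʳ b H = ∀ {a} → (a , b) ∉ H

module Strategy (width : ℕ) where
  open Generated branch width public

  length≤height : ∀ {t} p {u} → shapeAt t p ≡ just u → length p + height u ≤ height t
  length≤height []      refl = ≤-refl
  length≤height {t} (c ∷ p) {u} e with u₀ , e₀ , c-u ← shapeAt-∷⁻ p e = begin
    suc (length p + height u) ≡⟨ +-suc (length p) (height u) ⟨
    length p + suc (height u) ≤⟨ +-monoʳ-≤ (length p) (branch-height (proj₂ (child⇒branch c-u))) ⟩
    length p + height u₀      ≤⟨ length≤height p e₀ ⟩
    height t                  ∎
    where open ≤-Reasoning

  valid⇒length≤height : ∀ {t} p → Valid t p → length p ≤ height t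
  valid⇒length≤height p v with _ , e ← valid⇒shape p v = ≤-trans (m≤m+n _ _) (length≤height p e)

  module _ (0<width : 0 < width) where

    A⇒P  : ∀ {t} i (x : Vertex t) → shapeAt t (path x) ≡ just (A i) → P (tree t) i x
    B⇒¬P : ∀ {t} i (x : Vertex t) → shapeAt t (path x) ≡ just (B i) → ¬ P (tree t) i x

    A⇒P zero x ex y y→x with parent-shape {y = y} y→x ex
    ... | _ , _ , () , _
    A⇒P (suc i) x ex y y→x with parent-shape {y = y} y→x ex
    ... | _ , _ , refl , ey = B⇒¬P i y ey
    B⇒¬P zero x ex Px with y , y→x , _ ← child-vertex x {c = 0} ex 0<width refl = Px y y→x
    B⇒¬P (suc i) x ex Px with y , y→x , ey ← child-vertex x {c = 0} ex 0<width refl =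
      Px y y→x (A⇒P i y ey)

  -- The `copied` field keeps the children of equally shaped matched paths matched index by
  -- index, so that copying Spoiler's index never hits an already used path.
  record Matching (t t′ : Shape) (r : ℕ) (H : PathRel) : Set where
    field
      root∈     : ([] , []) ∈ H
      bijective : ∀ {a b a′ b′} → (a , b) ∈ H → (a′ , b′) ∈ H → (a ≡ a′) ⇔ (b ≡ b′)
      parent∈   : ∀ {c a d b} → (c ∷ a , d ∷ b) ∈ H → (a , b) ∈ H
      safe      : ∀ {a b} → (a , b) ∈ H →
                  ∃₂ λ u w → shapeAt t a ≡ just u × shapeAt t′ b ≡ just w × Safe r u w
      copied    : ∀ {c a d b} → (c ∷ a , d ∷ b) ∈ H → shapeAt t a ≡ shapeAt t′ b → c ≡ d

  module _ {t t′ r H} (M : Matching t t′ r H) where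
    open Matching M

    ∷-matchedˡ : ∀ {c a b} → (c ∷ a , b) ∈ H → ∃₂ λ d b′ → b ≡ d ∷ b′
    ∷-matchedˡ {b = []}     m with () ← from (bijective root∈ m) refl
    ∷-matchedˡ {b = d ∷ b′} m = d , b′ , refl

    ∷-matchedʳ : ∀ {a d b} → (a , d ∷ b) ∈ H → ∃₂ λ c a′ → a ≡ c ∷ a′
    ∷-matchedʳ {a = []}     m with () ← to (bijective root∈ m) refl
    ∷-matchedʳ {a = c ∷ a′} m = c , a′ , refl

    tail-matchedˡ : ∀ {a b a′ b′} → (a , b) ∈ H → (a′ , b′) ∈ H →
                    tail a′ ≡ just a → tail b′ ≡ just b
    tail-matchedˡ {a′ = _ ∷ _} m m′ e with _ , _ , refl ← ∷-matchedˡ m′ =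
      cong just (sym (to (bijective m (parent∈ m′)) (sym (just-injective e))))

    tail-matchedʳ : ∀ {a b a′ b′} → (a , b) ∈ H → (a′ , b′) ∈ H →
                    tail b′ ≡ just b → tail a′ ≡ just a
    tail-matchedʳ {b′ = _ ∷ _} m m′ e with _ , _ , refl ← ∷-matchedʳ m′ =
      cong just (sym (from (bijective m (parent∈ m′)) (sym (just-injective e))))

    tail⇔ : ∀ {a b a′ b′} → (a , b) ∈ H → (a′ , b′) ∈ H →
            (tail a′ ≡ just a) ⇔ (tail b′ ≡ just b)
    tail⇔ m m′ = mk⇔ (tail-matchedˡ m m′) (tail-matchedʳ m m′)

    copy-unmatched : ∀ {c p q} → (p , q) ∈ H → shapeAt t p ≡ shapeAt t′ q →
                     Unmatchedˡ (c ∷ p) H → Unmatchedʳ (c ∷ q) H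
    copy-unmatched pq p≈q unmatched m with _ , _ , refl ← ∷-matchedʳ m
      with refl ← from (bijective pq (parent∈ m)) refl
      with refl ← copied m p≈q = unmatched m

    Matching-∷ : ∀ {c p d q u′ w′} → (p , q) ∈ H → Unmatchedˡ (c ∷ p) H → Unmatchedʳ (d ∷ q) H →
                 shapeAt t (c ∷ p) ≡ just u′ → shapeAt t′ (d ∷ q) ≡ just w′ → Safe r u′ w′ →
                 (shapeAt t p ≡ shapeAt t′ q → c ≡ d) → Matching t t′ r ((c ∷ p , d ∷ q) ∷ H)
    Matching-∷ {c} {p} {d} {q} {u′} {w′} pq freeˡ freeʳ eu ew s c≡d = record
      { root∈ = there root∈ ; bijective = bijective′ ; parent∈ = parent∈′
      ; safe = safe′ ; copied = copied′ }
      where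
      H′ = (c ∷ p , d ∷ q) ∷ H
      bijective′ : ∀ {a b a′ b′} → (a , b) ∈ H′ → (a′ , b′) ∈ H′ → (a ≡ a′) ⇔ (b ≡ b′)
      bijective′ (here refl) (here refl) = mk⇔ (λ _ → refl) (λ _ → refl)
      bijective′ (here refl) (there m′)  =
        mk⇔ (λ { refl → ⊥-elim (freeˡ m′) }) (λ { refl → ⊥-elim (freeʳ m′) })
      bijective′ (there m)   (here refl) =
        mk⇔ (λ { refl → ⊥-elim (freeˡ m) }) (λ { refl → ⊥-elim (freeʳ m) })
      bijective′ (there m)   (there m′)  = bijective m m′
      parent∈′ : ∀ {c a d b} → (c ∷ a , d ∷ b) ∈ H′ → (a , b) ∈ H′
      parent∈′ (here refl) = there pq
      parent∈′ (there m)   = there (parent∈ m)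
      safe′ : ∀ {a b} → (a , b) ∈ H′ →
              ∃₂ λ u w → shapeAt t a ≡ just u × shapeAt t′ b ≡ just w × Safe r u w
      safe′ (here refl) = u′ , w′ , eu , ew , s
      safe′ (there m)   = safe m
      copied′ : ∀ {c a d b} → (c ∷ a , d ∷ b) ∈ H′ → shapeAt t a ≡ shapeAt t′ b → c ≡ d
      copied′ (here refl) = c≡d
      copied′ (there m)   = copied m

  Matching-root : ∀ {t t′ r} → Safe r t t′ → Matching t t′ r (([] , []) ∷ [])
  Matching-root s = record
    { root∈ = here refl
    ; bijective = λ { (here refl) (here refl) → mk⇔ (λ _ → refl) (λ _ → refl) }
    ; parent∈ = λ { (here ()) ; (there ()) }
    ; safe = λ { (here refl) → _ , _ , refl , refl , s }
    ; copied = λ { (here ()) ; (there ()) } }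

  Matching-swap : ∀ {t t′ r H} → Matching t t′ (suc r) H → Matching t′ t r (map swap H)
  Matching-swap M = record
    { root∈ = ∈-map⁺ swap root∈
    ; bijective = λ m m′ → ⇔-sym (bijective (∈-map-swap⁻ m) (∈-map-swap⁻ m′))
    ; parent∈ = λ m → ∈-map⁺ swap (parent∈ (∈-map-swap⁻ m))
    ; safe = λ m → let u , w , eu , ew , s = safe (∈-map-swap⁻ m) in w , u , ew , eu , Safe-swap s
    ; copied = λ m e → sym (copied (∈-map-swap⁻ m) (sym e)) }
    where open Matching M

  fresh-index : ∀ (H : PathRel) q → suc (length H) < width →
                ∃ λ e → suc e < width × Unmatchedʳ (suc e ∷ q) H
  fresh-index H q room =
    let e , e≤ , e∉ = ∃∉≤length (map predHeadʳ H)
    in e , ≤-<-trans (s≤s (≤-trans e≤ (≤-reflexive (length-map predHeadʳ H)))) room ,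
       e∉ ∘ ∈-map⁺ predHeadʳ
    where
    predHeadʳ : List ℕ × List ℕ → ℕ
    predHeadʳ (_ , d ∷ _) = pred d
    predHeadʳ (_ , [])    = 0

  _⊑_ : ∀ {t t′} → List (Vertex t × Vertex t′) → PathRel → Set
  h ⊑ H = ∀ {x y} → (x , y) ∈ h → (path x , path y) ∈ H

  Matching⇒Good : ∀ {t t′ r H h} → Matching t t′ r H → h ⊑ H → Good (tree t) (tree t′) h
  Matching⇒Good M h⊑H {x₁} {y₁} {x₂} {y₂} m₁ m₂ =
    ⇔-sym (parent⇔tail y₁ y₂) ⇔-∘ (tail⇔ M (h⊑H m₁) (h⊑H m₂) ⇔-∘ parent⇔tail x₁ x₂) ,
    ⇔-sym path-≡⇔ ⇔-∘ (Matching.bijective M (h⊑H m₁) (h⊑H m₂) ⇔-∘ path-≡⇔)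

  module _ {t t′ r H c p q} (M : Matching t t′ r H) (pq : (p , q) ∈ H) (v : Valid t (c ∷ p))
           (freeˡ : Unmatchedˡ (c ∷ p) H) where

    extend-copy : shapeAt t p ≡ shapeAt t′ q → Matching t t′ r ((c ∷ p , c ∷ q) ∷ H)
    extend-copy p≈q with u′ , eu′ ← valid⇒shape (c ∷ p) v =
      Matching-∷ M pq freeˡ (copy-unmatched M pq p≈q freeˡ) eu′
        (trans (cong (_>>= λ u → child u c) (sym p≈q)) eu′) same (λ _ → refl)

    extend-fresh : ∀ {u w} → 0 < r → suc (length H) < width →
                   shapeAt t p ≡ just u → shapeAt t′ q ≡ just w → Safe r u w → u ≢ w →
                   ∃ λ d → Matching t t′ r ((c ∷ p , d ∷ q) ∷ H)
    extend-fresh 0<r room eu ew s u≢w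
      with u′ , eu′ ← valid⇒shape (c ∷ p) v
      with c<w , bu ← child⇒branch (trans (sym (shapeAt-∷ p eu)) eu′)
      with w′ , bw , s′ ← fresh-reply 0<r s u≢w bu
      with e , e<w , freeʳ ← fresh-index H q room =
      suc e ,
      Matching-∷ M pq freeˡ freeʳ eu′ (trans (shapeAt-∷ q ew) (trans (branch⇒child e<w) (bw e))) s′
        (λ p≈q → ⊥-elim (u≢w (just-injective (trans (sym eu) (trans p≈q ew)))))

  extend : ∀ {t t′ r H c p q} → Matching t t′ r H → 0 < r → suc (length H) < width →
           (p , q) ∈ H → Valid t (c ∷ p) → Unmatchedˡ (c ∷ p) H →
           ∃ λ d → Matching t t′ r ((c ∷ p , d ∷ q) ∷ H)
  extend M 0<r room pq v freeˡ with Matching.safe M pq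
  ... | _ , _ , eu , ew , same      = _ , extend-copy M pq v freeˡ (trans eu (sym ew))
  ... | _ , _ , eu , ew , s@(A~B _) = extend-fresh M pq v freeˡ 0<r room eu ew s λ ()
  ... | _ , _ , eu , ew , s@(B~A _) = extend-fresh M pq v freeˡ 0<r room eu ew s λ ()

  match : ∀ {t t′ r H} → Matching t t′ r H → 0 < r → ∀ p → Valid t p →
          suc (length H + length p) < width →
          ∃₂ λ q H′ → (p , q) ∈ H′ × H ⊆ H′ × Matching t t′ r H′ ×
                      length H′ ≤ length H + length p
  match {H = H} M 0<r [] _ _ = [] , H , Matching.root∈ M , id , M , m≤m+n _ _
  match {H = H} M 0<r (c ∷ p) v room
    with room′ ← ≤-<-trans (s≤s (+-monoʳ-≤ (length H) (n≤1+n (length p)))) room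
    with q , H₁ , pq , H⊆H₁ , M₁ , |H₁| ← match M 0<r p (valid-∷ p v) room′
    with (c ∷ p) ∈ₗ? map proj₁ H₁
  ... | yes m with (_ , b) , m₁ , refl ← ∈-map⁻ proj₁ m =
    b , H₁ , m₁ , H⊆H₁ , M₁ , ≤-trans |H₁| (+-monoʳ-≤ (length H) (n≤1+n _))
  ... | no m with d , M′ ← extend M₁ 0<r (≤-<-trans (s≤s |H₁|) room′) pq v (m ∘ ∈-map⁺ proj₁) =
    d ∷ q , _ , here refl , there ∘ H⊆H₁ , M′ , ≤-trans (s≤s |H₁|) (≤-reflexive (sym (+-suc _ _)))

module Game (s k : ℕ) where

  maxHeight : ℕ
  maxHeight = height (B s)

  -- Matching a Spoiler vertex adds at most maxHeight pairs (its unmatched ancestors), so with the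
  -- root pair the matching never exceeds capacity pairs; width = capacity + 2 leaves room for a
  -- fresh nonzero index.
  capacity : ℕ
  capacity = suc (s * k * maxHeight)

  open Strategy (suc (suc capacity)) public

  top : Bool → Shape
  top true  = A s
  top false = B s

  top-height : ∀ i → height (top i) ≤ maxHeight
  top-height true  = height-A≤B s
  top-height false = ≤-refl

  record Inv (i j : Bool) (r R : ℕ) (h : List (Vertex (top i) × Vertex (top j))) : Set where
    constructor inv
    field
      H        : PathRel
      matching : Matching (top i) (top j) r H
      budget   : length H + R * maxHeight ≤ capacity
      tracked  : h ⊑ H

  spend : ∀ {n l R} → l ≤ maxHeight → n + suc R * maxHeight ≤ capacity →
          n + l + R * maxHeight ≤ capacity
  spend {n} {l} {R} l≤max budget = begin
    n + l + R * maxHeight           ≡⟨ +-assoc n l _ ⟩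
    n + (l + R * maxHeight)         ≤⟨ +-monoʳ-≤ n (+-monoˡ-≤ _ l≤max) ⟩
    n + (maxHeight + R * maxHeight) ≤⟨ budget ⟩
    capacity                        ∎
    where open ≤-Reasoning

  respond : ∀ {i j r R h} → Inv i j (suc r) (suc R) h →
            ∀ x → ∃ λ y → Inv i j (suc r) R ((x , y) ∷ h)
  respond {i} {R = R} (inv H M budget h⊑H) (p , v)
    with fits ← spend {R = R} (≤-trans (valid⇒length≤height p v) (top-height i)) budget
    with q , H′ , pq , H⊆H′ , M′ , |H′| ← match M z<s p v (s≤s (s≤s (≤-trans (m≤m+n _ _) fits)))
    with _ , _ , _ , eq , _ ← Matching.safe M′ pq =
    (q , shape⇒valid q eq) , inv H′ M′ (≤-trans (+-monoˡ-≤ (R * maxHeight) |H′|) fits)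
      λ { (here refl) → pq ; (there m) → H⊆H′ (h⊑H m) }

  switch : ∀ {i j r R h} → Inv i j (suc r) R h → Inv j i r R (map swap h)
  switch {R = R} (inv H M budget h⊑H) =
    inv (map swap H) (Matching-swap M)
      (subst (λ n → n + R * maxHeight ≤ capacity) (sym (length-map swap H)) budget)
      (λ m → ∈-map⁺ swap (h⊑H (∈-map-swap⁻ m)))

  initial : ∀ {i j} → Safe s (top i) (top j) → Inv i j s (s * k) ((([] , tt) , ([] , tt)) ∷ [])
  initial safe = inv _ (Matching-root safe) ≤-refl λ { (here refl) → here refl }

  open ByInvariant (tree ∘ top) k Inv respond switch (λ (inv _ M _ h⊑H) → Matching⇒Good M h⊑H)

  duplicatorWins : DuplicatorWinsEhr (tree (A s)) (tree (B s)) s k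
  duplicatorWins true  = dupWins s (initial {true} {false} (A~B (n≤1+n s)))
  duplicatorWins false =
    subst (λ l → DupWins (tree (A s)) (tree (B s)) l _) (sym (schedule-not true s k))
      (DupWins-swap (tree (A s)) (tree (B s)) _ (dupWins s (initial {false} {true} (B~A ≤-refl))))

mainTheorem2 : (s k : ℕ) → 1 ≤ s → 1 ≤ k →
    Σ RootedTree λ T₁ → Σ RootedTree λ T₂ →
      LocallyFinite T₁ × LocallyFinite T₂ ×
      KEIN s T₁ × ¬ KEIN s T₂ × DuplicatorWinsEhr T₁ T₂ s k
mainTheorem2 s k _ _ =
  tree (A s) , tree (B s) , locallyFinite (A s) , locallyFinite (B s) ,
  A⇒P z<s s ([] , tt) refl , B⇒¬P z<s s ([] , tt) refl , duplicatorWins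
  where open Game s k
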